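{- Let $p$ be a prime, $n$ a positive integer, and $G$ a cyclic group of order $p^n$. Then $OD(G)$ is isomorphic to the complete $(n+1)$-partite graph $K_{1,\,p-1,\,p(p-1),\,p^2(p-1),\,\dots,\,p^{n-1}(p-1)}$.
   Context: For a finite group $G$, the order divisor graph $OD(G)$ is the simple undirected graph with vertex set $G$ in which two distinct vertices $a,b$ are adjacent if and only if $o(a)\neq o(b)$ and either $o(a)\mid o(b)$ or $o(b)\mid o(a)$. $K_{m_1,\dots,m_k}$ denotes the complete $k$-partite graph with parts of sizes $m_1,\dots,m_k$. -}

module Defs where

open import Level using (Level; _⊔_)
open import Algebra.Bundles using (Group)
open import Data.Nat using (ℕ; zero; suc; _*_; _∸_; _^_; _≤_; _<_)
open import Data.Nat.Divisibility using (_∣_)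
open import Data.Integer using (ℤ; +_; -[1+_])
open import Data.Fin using (Fin)
open import Data.Product using (Σ; _×_; ∃; ∃₂; proj₁)
open import Data.Sum using (_⊎_)
open import Relation.Nullary using (¬_)
open import Relation.Binary.Bundles using (Setoid)
open import Relation.Binary.PropositionalEquality as ≡ using (_≡_)
open import Function.Bundles using (Bijection; _⇔_)

module _ {c ℓ} (G : Group c ℓ) where
  open Group G

  pow : Carrier → ℕ → Carrier
  pow x zero    = ε
  pow x (suc k) = x ∙ pow x k

  powℤ : Carrier → ℤ → Carrier
  powℤ x (+ k)      = pow x k
  powℤ x -[1+ k ]   = (pow x (suc k)) ⁻¹

  HasOrder : ℕ → Set (c ⊔ ℓ)
  HasOrder N = Bijection (≡.setoid (Fin N)) setoid

  IsCyclic : Set (c ⊔ ℓ)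
  IsCyclic = Σ Carrier λ g → ∀ x → Σ ℤ λ k → powℤ g k ≈ x

  ElemOrder : Carrier → ℕ → Set ℓ
  ElemOrder a k = (1 ≤ k) × (pow a k ≈ ε) × (∀ j → 1 ≤ j → j < k → ¬ (pow a j ≈ ε))

record Graph (v ℓ r : Level) : Set (Level.suc (v ⊔ ℓ ⊔ r)) where
  field
    V   : Setoid v ℓ
    Adj : Setoid.Carrier V → Setoid.Carrier V → Set r

record _≅G_ {v₁ ℓ₁ r₁ v₂ ℓ₂ r₂} (Γ : Graph v₁ ℓ₁ r₁) (Δ : Graph v₂ ℓ₂ r₂)
       : Set (v₁ ⊔ ℓ₁ ⊔ r₁ ⊔ v₂ ⊔ ℓ₂ ⊔ r₂) where
  field
    bij : Bijection (Graph.V Γ) (Graph.V Δ)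
    adj : ∀ a b → Graph.Adj Γ a b ⇔ Graph.Adj Δ (Bijection.to bij a) (Bijection.to bij b)

OD : ∀ {c ℓ} (G : Group c ℓ) → Graph c ℓ ℓ
OD G = record
  { V   = setoid
  ; Adj = λ a b → ¬ (a ≈ b) × ∃₂ λ k l →
            ElemOrder G a k × ElemOrder G b l × ¬ (k ≡ l) × ((k ∣ l) ⊎ (l ∣ k))
  }
  where open Group G

CompleteMultipartite : (k : ℕ) → (Fin k → ℕ) → Graph Level.zero Level.zero Level.zero
CompleteMultipartite k m = record
  { V   = ≡.setoid (Σ (Fin k) λ i → Fin (m i))
  ; Adj = λ x y → ¬ (proj₁ x ≡ proj₁ y)
  }

partSize : ℕ → ℕ → ℕ
partSize p zero    = 1
partSize p (suc i) = p ^ i * (p ∸ 1)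

-- A generator g makes k ↦ g^k a bijection from {0, …, p^n - 1} onto G, and g^(p^j u) with p ∤ u
-- has order p^(n-j). Grouping the exponents by their p-adic valuation therefore splits G into the
-- classes of elements of order 1, p, …, p^n, of sizes 1, p - 1, p(p - 1), …, p^(n-1)(p - 1). These
-- orders form a divisibility chain, so two elements are adjacent in OD(G) exactly when they lie in
-- different classes.
module Submission where

open import Defs
open import Algebra.Bundles using (Group)
open import Data.Empty using (⊥-elim)
open import Data.Fin using (Fin; toℕ; fromℕ<; combine; remQuot; opposite)
  renaming (zero to fzero; suc to fsuc)
open import Data.Fin.Properties
  using (pigeonhole; injective⇒≤; toℕ-fromℕ<; toℕ<n; toℕ-injective; toℕ-combine
        ; opposite-prop; opposite-involutive
        ; remQuot-combine; combine-remQuot; combine-injective)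
  renaming (suc-injective to fsuc-injective)
open import Data.Integer using (+_; -[1+_])
open import Data.Nat
open import Data.Nat.DivMod using (_%_; _/_; m%n<n; m≡m%n+[m/n]*n)
open import Data.Nat.Divisibility
open import Data.Nat.Induction using (<-rec)
open import Data.Nat.Primality using (Prime; euclidsLemma; prime⇒nonZero; ¬prime[0]; ¬prime[1])
open import Data.Nat.Properties
open import Data.Nat.Tactic.RingSolver using (solve-∀)
open import Data.Product using (Σ; ∃; ∃₂; _×_; _,_; proj₁; proj₂; uncurry)
open import Data.Sum as Sum using (_⊎_; inj₁; inj₂)
open import Function using (_∘_)
open import Function.Bundles using (Bijection; Surjection; mk⇔)
open import Function.Consequences using (strictlySurjective⇒surjective)
import Function.Construct.Symmetry as Symmetry
open import Relation.Binary.Definitions using (tri<; tri≈; tri>)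
open import Relation.Binary.PropositionalEquality as ≡ using (_≡_)
open import Relation.Nullary using (¬_; yes; no)

^-injectiveʳ : ∀ {p a b} → 1 < p → p ^ a ≡ p ^ b → a ≡ b
^-injectiveʳ {p} {a} {b} 1<p pᵃ≡pᵇ with <-cmp a b
... | tri< a<b _ _ = ⊥-elim (<-irrefl pᵃ≡pᵇ (^-monoʳ-< p 1<p a<b))
... | tri≈ _ a≡b _ = a≡b
... | tri> _ _ b<a = ⊥-elim (<-irrefl (≡.sym pᵃ≡pᵇ) (^-monoʳ-< p 1<p b<a))

^-monoʳ-∣ : ∀ p {a b} → a ≤ b → p ^ a ∣ p ^ b
^-monoʳ-∣ p {a} {b} a≤b = divides (p ^ (b ∸ a))
  (≡.trans (≡.cong (p ^_) (≡.sym (m∸n+n≡m a≤b))) (^-distribˡ-+-* p (b ∸ a) a))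

^-∣-total : ∀ p a b → p ^ a ∣ p ^ b ⊎ p ^ b ∣ p ^ a
^-∣-total p a b = Sum.map (^-monoʳ-∣ p) (^-monoʳ-∣ p) (≤-total a b)

^-split : ∀ p {i n} → i < n → p ^ n ≡ p ^ (n ∸ suc i) * p ^ suc i
^-split p {i} {n} i<n =
  ≡.trans (≡.cong (p ^_) (≡.sym (m∸n+n≡m i<n))) (^-distribˡ-+-* p (n ∸ suc i) (suc i))

prime^∣*-cancelˡ : ∀ {p u t} → Prime p → ¬ p ∣ u → ∀ k → p ^ k ∣ u * t → p ^ k ∣ t
prime^∣*-cancelˡ {t = t} _ _ zero _ = 1∣ t
prime^∣*-cancelˡ {p} {u} {t} p-prime p∤u (suc k) pᵏ⁺¹∣ut
  with euclidsLemma u t p-prime (∣-trans (m∣m*n (p ^ k)) pᵏ⁺¹∣ut)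
... | inj₁ p∣u = ⊥-elim (p∤u p∣u)
... | inj₂ (divides t′ ≡.refl) = ≡.subst (p ^ suc k ∣_) (*-comm p t′) (*-monoʳ-∣ p pᵏ∣t′)
  where
  instance
    p≢0 : NonZero p
    p≢0 = prime⇒nonZero p-prime

  pᵏ∣ut′ : p ^ k ∣ u * t′
  pᵏ∣ut′ = *-cancelˡ-∣ p (≡.subst (p ^ suc k ∣_) (reorder u t′ p) pᵏ⁺¹∣ut)
    where
    reorder : ∀ a b c → a * (b * c) ≡ c * (a * b)
    reorder = solve-∀

  pᵏ∣t′ : p ^ k ∣ t′
  pᵏ∣t′ = prime^∣*-cancelˡ p-prime p∤u k pᵏ∣ut′

p-adic-decomposition : ∀ {p} → 1 < p → ∀ k → 0 < k → ∃₂ λ j u → k ≡ p ^ j * u × ¬ p ∣ u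
p-adic-decomposition {p} 1<p = <-rec Decomposable decompose
  where
  Decomposable : ℕ → Set
  Decomposable k = 0 < k → ∃₂ λ j u → k ≡ p ^ j * u × ¬ p ∣ u

  reorder : ∀ a b c → a * b * c ≡ c * a * b
  reorder = solve-∀

  decompose : ∀ k → (∀ {k′} → k′ < k → Decomposable k′) → Decomposable k
  decompose k rec k>0 with p ∣? k
  ... | no p∤k = 0 , k , ≡.sym (*-identityˡ k) , p∤k
  ... | yes (divides zero ≡.refl) = ⊥-elim (<-irrefl ≡.refl k>0)
  ... | yes (divides k′@(suc _) ≡.refl)
    with j , u , k′≡pʲu , p∤u ← rec (m<m*n k′ p 1<p) z<s =
      suc j , u , ≡.trans (≡.cong (_* p) k′≡pʲu) (reorder (p ^ j) u p) , p∤u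

module GroupPowers {c ℓ} (G : Group c ℓ) where
  open Group G
  open import Algebra.Properties.Group G using (identityˡ-unique; inverseˡ-unique)
  open import Relation.Binary.Reasoning.Setoid setoid

  pow-+ : ∀ x a b → pow G x (a + b) ≈ pow G x a ∙ pow G x b
  pow-+ x zero    b = sym (identityˡ _)
  pow-+ x (suc a) b = trans (∙-congˡ (pow-+ x a b)) (sym (assoc _ _ _))

  pow-congˡ : ∀ {x y} k → x ≈ y → pow G x k ≈ pow G y k
  pow-congˡ zero    _   = refl
  pow-congˡ (suc k) x≈y = ∙-cong x≈y (pow-congˡ k x≈y)

  pow-congʳ : ∀ x {a b} → a ≡ b → pow G x a ≈ pow G x b
  pow-congʳ x ≡.refl = refl

  pow-ε : ∀ k → pow G ε k ≈ ε
  pow-ε zero    = refl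
  pow-ε (suc k) = trans (identityˡ _) (pow-ε k)

  pow-* : ∀ x a b → pow G (pow G x a) b ≈ pow G x (b * a)
  pow-* x a zero    = refl
  pow-* x a (suc b) = trans (∙-congˡ (pow-* x a b)) (sym (pow-+ x a (b * a)))

  pow-*-≈ε : ∀ x a b → pow G x a ≈ ε → pow G x (b * a) ≈ ε
  pow-*-≈ε x a b xᵃ≈ε = begin
    pow G x (b * a)      ≈⟨ pow-* x a b ⟨
    pow G (pow G x a) b  ≈⟨ pow-congˡ b xᵃ≈ε ⟩
    pow G ε b            ≈⟨ pow-ε b ⟩
    ε                    ∎

  pow-% : ∀ x e .{{_ : NonZero e}} → pow G x e ≈ ε → ∀ m → pow G x (m % e) ≈ pow G x m
  pow-% x e xᵉ≈ε m = begin
    pow G x (m % e)                          ≈⟨ identityʳ _ ⟨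
    pow G x (m % e) ∙ ε                      ≈⟨ ∙-congˡ (pow-*-≈ε x e (m / e) xᵉ≈ε) ⟨
    pow G x (m % e) ∙ pow G x (m / e * e)    ≈⟨ pow-+ x (m % e) (m / e * e) ⟨
    pow G x (m % e + m / e * e)              ≈⟨ pow-congʳ x (m≡m%n+[m/n]*n m e) ⟨
    pow G x m                                ∎

  powℤ-reduce : ∀ x e .{{_ : NonZero e}} → pow G x e ≈ ε →
                ∀ z → ∃ λ r → r < e × pow G x r ≈ powℤ G x z
  powℤ-reduce x e xᵉ≈ε (+ k) = k % e , m%n<n k e , pow-% x e xᵉ≈ε k
  powℤ-reduce x e@(suc e-1) xᵉ≈ε -[1+ k ] = m % e , m%n<n m e , trans (pow-% x e xᵉ≈ε m) xᵐ≈[xᵏ⁺¹]⁻¹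
    where
    m : ℕ
    m = e-1 * suc k

    xᵐ≈[xᵏ⁺¹]⁻¹ : pow G x m ≈ pow G x (suc k) ⁻¹
    xᵐ≈[xᵏ⁺¹]⁻¹ = inverseˡ-unique _ _ (begin
      pow G x m ∙ pow G x (suc k)  ≈⟨ pow-+ x m (suc k) ⟨
      pow G x (m + suc k)          ≈⟨ pow-congʳ x (≡.trans (+-comm m (suc k)) (*-comm e (suc k))) ⟩
      pow G x (suc k * e)          ≈⟨ pow-*-≈ε x e (suc k) xᵉ≈ε ⟩
      ε                            ∎)

  pow-∸-≈ε : ∀ x {a b} → a ≤ b → pow G x a ≈ pow G x b → pow G x (b ∸ a) ≈ ε
  pow-∸-≈ε x {a} {b} a≤b xᵃ≈xᵇ = identityˡ-unique _ _ (begin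
    pow G x (b ∸ a) ∙ pow G x a  ≈⟨ pow-+ x (b ∸ a) a ⟨
    pow G x (b ∸ a + a)          ≈⟨ pow-congʳ x (m∸n+n≡m a≤b) ⟩
    pow G x b                    ≈⟨ xᵃ≈xᵇ ⟨
    pow G x a                    ∎)

  elemOrder-unique : ∀ {x k l} → ElemOrder G x k → ElemOrder G x l → k ≡ l
  elemOrder-unique {k = k} {l} (k≥1 , xᵏ≈ε , k-least) (l≥1 , xˡ≈ε , l-least) with <-cmp k l
  ... | tri< k<l _ _ = ⊥-elim (l-least k k≥1 k<l xᵏ≈ε)
  ... | tri≈ _ k≡l _ = k≡l
  ... | tri> _ _ l<k = ⊥-elim (k-least l l≥1 l<k xˡ≈ε)

  elemOrder-resp : ∀ {x y k} → x ≈ y → ElemOrder G x k → ElemOrder G y k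
  elemOrder-resp {k = k} x≈y (k≥1 , xᵏ≈ε , k-least) =
    k≥1 , trans (pow-congˡ k (sym x≈y)) xᵏ≈ε ,
    λ j j≥1 j<k yʲ≈ε → k-least j j≥1 j<k (trans (pow-congˡ j x≈y) yʲ≈ε)

  elemOrder-ε : ElemOrder G ε 1
  elemOrder-ε = ≤-refl , identityʳ ε , λ j j≥1 j<1 _ → <⇒≱ j<1 j≥1

  elemOrder-pow : ∀ {g N} d P u .{{_ : NonZero d}} .{{_ : NonZero P}} →
                  pow G g N ≈ ε → (∀ a → pow G g a ≈ ε → N ∣ a) → N ≡ d * P →
                  (∀ t → P ∣ u * t → P ∣ t) → ElemOrder G (pow G g (d * u)) P
  elemOrder-pow {g} {N} d P u gᴺ≈ε period N≡dP P-cancels = >-nonZero⁻¹ P , gᵈᵘᴾ≈ε , least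
    where
    reorder : ∀ a b c → b * (a * c) ≡ c * (a * b)
    reorder = solve-∀

    gᵈᵘᴾ≈ε : pow G (pow G g (d * u)) P ≈ ε
    gᵈᵘᴾ≈ε = begin
      pow G (pow G g (d * u)) P  ≈⟨ pow-* g (d * u) P ⟩
      pow G g (P * (d * u))      ≈⟨ pow-congʳ g (≡.trans (reorder d P u) (≡.cong (u *_) (≡.sym N≡dP))) ⟩
      pow G g (u * N)            ≈⟨ pow-*-≈ε g N u gᴺ≈ε ⟩
      ε                          ∎

    least : ∀ t → 1 ≤ t → t < P → ¬ (pow G (pow G g (d * u)) t ≈ ε)
    least t t≥1 t<P gᵈᵘᵗ≈ε = <⇒≱ t<P (∣⇒≤ {{>-nonZero t≥1}} (P-cancels t (*-cancelˡ-∣ d dP∣dut)))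
      where
      dP∣dut : d * P ∣ d * (u * t)
      dP∣dut = ≡.subst₂ _∣_ N≡dP (≡.trans (*-comm t (d * u)) (*-assoc d u t))
                 (period _ (trans (sym (pow-* g (d * u) t)) gᵈᵘᵗ≈ε))

module _ {c ℓ} (G : Group c ℓ) where
  open Group G
  open GroupPowers G

  OD≅CompleteMultipartite :
    ∀ {k} {m : Fin k → ℕ} (ord : Fin k → ℕ) → (∀ {i j} → ord i ≡ ord j → i ≡ j) →
    (∀ i j → ord i ∣ ord j ⊎ ord j ∣ ord i) →
    (ψ : Bijection (≡.setoid (Σ (Fin k) λ i → Fin (m i))) setoid) →
    (∀ v → ElemOrder G (Bijection.to ψ v) (ord (proj₁ v))) →
    OD G ≅G CompleteMultipartite k m
  OD≅CompleteMultipartite ord ord-injective ord-chain ψ ψ-elemOrder =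
    record { bij = φ ; adj = λ a b → mk⇔ (separated a b) (joined a b) }
    where
    open Bijection ψ using (to⁻; injective; surjection)
    open Surjection surjection using (to∘to⁻)

    φ : Bijection setoid (≡.setoid _)
    φ = Symmetry.bijection ψ λ {x} {y} x≈y →
          injective (trans (to∘to⁻ x) (trans x≈y (sym (to∘to⁻ y))))

    part : Carrier → Fin _
    part a = proj₁ (to⁻ a)

    elemOrder-part : ∀ a → ElemOrder G a (ord (part a))
    elemOrder-part a = elemOrder-resp (to∘to⁻ a) (ψ-elemOrder (to⁻ a))

    separated : ∀ a b → Graph.Adj (OD G) a b → ¬ (part a ≡ part b)
    separated a b (_ , k , l , k-order , l-order , k≢l , _) same-part =
      k≢l (≡.trans (elemOrder-unique k-order (elemOrder-part a))
          (≡.trans (≡.cong ord same-part) (elemOrder-unique (elemOrder-part b) l-order)))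

    joined : ∀ a b → ¬ (part a ≡ part b) → Graph.Adj (OD G) a b
    joined a b parts-differ =
      (λ a≈b → orders-differ
         (elemOrder-unique (elemOrder-resp a≈b (elemOrder-part a)) (elemOrder-part b))) ,
      _ , _ , elemOrder-part a , elemOrder-part b , orders-differ , ord-chain (part a) (part b)
      where
      orders-differ : ¬ (ord (part a) ≡ ord (part b))
      orders-differ = parts-differ ∘ ord-injective

module CyclicGroup {c ℓ} (G : Group c ℓ) {N : ℕ} .{{_ : NonZero N}}
                   (order : HasOrder G N) (cyclic : IsCyclic G) where
  open Group G
  open GroupPowers G
  open Surjection (Bijection.surjection order) using (to⁻; to∘to⁻)

  g : Carrier
  g = proj₁ cyclic

  pow-reduce : ∀ e .{{_ : NonZero e}} → pow G g e ≈ ε → ∀ x → ∃ λ (r : Fin e) → pow G g (toℕ r) ≈ x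
  pow-reduce e gᵉ≈ε x with k , gᵏ≈x ← proj₂ cyclic x
                      with r , r<e , gʳ≈gᵏ ← powℤ-reduce g e gᵉ≈ε k =
    fromℕ< r<e , trans (pow-congʳ g (toℕ-fromℕ< r<e)) (trans gʳ≈gᵏ gᵏ≈x)

  -- Reducing exponents mod a period e injects the N elements of G into Fin e.
  order≤period : ∀ e .{{_ : NonZero e}} → pow G g e ≈ ε → N ≤ e
  order≤period e gᵉ≈ε = injective⇒≤ {f = logarithm} logarithm-injective
    where
    open Bijection order using (to; injective)

    logarithm : Fin N → Fin e
    logarithm i = proj₁ (pow-reduce e gᵉ≈ε (to i))

    logarithm-injective : ∀ {i j} → logarithm i ≡ logarithm j → i ≡ j
    logarithm-injective {i} {j} logᵢ≡logⱼ = injective (begin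
      to i                         ≈⟨ proj₂ (pow-reduce e gᵉ≈ε (to i)) ⟨
      pow G g (toℕ (logarithm i))  ≈⟨ pow-congʳ g (≡.cong toℕ logᵢ≡logⱼ) ⟩
      pow G g (toℕ (logarithm j))  ≈⟨ proj₂ (pow-reduce e gᵉ≈ε (to j)) ⟩
      to j                         ∎)
      where open import Relation.Binary.Reasoning.Setoid setoid

  -- Two of g^0, …, g^N coincide; their distance is a period, hence exactly N.
  pow-N≈ε : pow G g N ≈ ε
  pow-N≈ε with i , j , i<j , collision ← pigeonhole (n<1+n N) (to⁻ ∘ pow G g ∘ toℕ) =
    trans (pow-congʳ g (≡.sym d≡N)) gᵈ≈ε
    where
    open Bijection order using (cong)

    d : ℕ
    d = toℕ j ∸ toℕ i

    gᵈ≈ε : pow G g d ≈ ε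
    gᵈ≈ε = pow-∸-≈ε g (<⇒≤ i<j)
             (trans (sym (to∘to⁻ _)) (trans (cong collision) (to∘to⁻ _)))

    d≡N : d ≡ N
    d≡N = ≤-antisym (≤-trans (m∸n≤m (toℕ j) (toℕ i)) (s≤s⁻¹ (toℕ<n j)))
                    (order≤period d {{>-nonZero (m<n⇒0<n∸m i<j)}} gᵈ≈ε)

  pow-distinct : ∀ {a b} → a < b → b < N → ¬ (pow G g a ≈ pow G g b)
  pow-distinct {a} {b} a<b b<N gᵃ≈gᵇ =
    <⇒≱ (≤-<-trans (m∸n≤m b a) b<N)
        (order≤period (b ∸ a) {{>-nonZero (m<n⇒0<n∸m a<b)}} (pow-∸-≈ε g (<⇒≤ a<b) gᵃ≈gᵇ))

  pow-injective : ∀ {a b} → a < N → b < N → pow G g a ≈ pow G g b → a ≡ b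
  pow-injective {a} {b} a<N b<N gᵃ≈gᵇ with <-cmp a b
  ... | tri< a<b _ _ = ⊥-elim (pow-distinct a<b b<N gᵃ≈gᵇ)
  ... | tri≈ _ a≡b _ = a≡b
  ... | tri> _ _ b<a = ⊥-elim (pow-distinct b<a a<N (sym gᵃ≈gᵇ))

  pow≈ε⇒∣ : ∀ a → pow G g a ≈ ε → N ∣ a
  pow≈ε⇒∣ a gᵃ≈ε = m%n≡0⇒n∣m a N
    (pow-injective (m%n<n a N) (>-nonZero⁻¹ N) (trans (pow-% g N pow-N≈ε a) gᵃ≈ε))

module PrimePowerExponents (q : ℕ) where
  p : ℕ
  p = suc (suc q)

  1<p : 1 < p
  1<p = s≤s (s≤s z≤n)

  -- (a , r) ↦ a p + (r + 1): the numbers below m p that p does not divide.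
  coprimeResidue : ∀ m → Fin (m * suc q) → Fin (m * p)
  coprimeResidue m x = uncurry (λ a r → combine a (fsuc r)) (remQuot {m} (suc q) x)

  coprimeResidue-∤ : ∀ m (x : Fin (m * suc q)) → ¬ p ∣ toℕ (coprimeResidue m x)
  coprimeResidue-∤ m x p∣residue = <⇒≱ (s≤s (toℕ<n r)) (∣⇒≤ p∣r+1)
    where
    a = proj₁ (remQuot {m} (suc q) x)
    r = proj₂ (remQuot {m} (suc q) x)

    p∣r+1 : p ∣ suc (toℕ r)
    p∣r+1 = ∣m+n∣m⇒∣n (≡.subst (p ∣_) (toℕ-combine a (fsuc r)) p∣residue) (m∣m*n (toℕ a))

  coprimeResidue-injective : ∀ {m} {x y : Fin (m * suc q)} →
                             coprimeResidue m x ≡ coprimeResidue m y → x ≡ y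
  coprimeResidue-injective {m} {x} {y} residues-equal
    with a≡b , r+1≡s+1 ← combine-injective {m} {p} _ _ _ _ residues-equal = begin
      x                                        ≡⟨ combine-remQuot {m} (suc q) x ⟨
      uncurry combine (remQuot {m} (suc q) x)  ≡⟨ ≡.cong₂ combine a≡b (fsuc-injective r+1≡s+1) ⟩
      uncurry combine (remQuot {m} (suc q) y)  ≡⟨ combine-remQuot {m} (suc q) y ⟩
      y                                        ∎
    where open ≡.≡-Reasoning

  coprimeResidue-surjective : ∀ {m} (z : Fin (m * p)) → ¬ p ∣ toℕ z →
                              ∃ λ x → coprimeResidue m x ≡ z
  coprimeResidue-surjective {m} z p∤z with remQuot {m} p z in split
  ... | a , fzero = ⊥-elim (p∤z (divides (toℕ a) (begin
        toℕ z                   ≡⟨ ≡.cong toℕ (z≡combine split) ⟩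
        toℕ (combine a fzero)   ≡⟨ toℕ-combine a fzero ⟩
        p * toℕ a + 0           ≡⟨ +-identityʳ _ ⟩
        p * toℕ a               ≡⟨ *-comm p (toℕ a) ⟩
        toℕ a * p               ∎)))
    where open ≡.≡-Reasoning
          z≡combine : ∀ {a b} → remQuot {m} p z ≡ (a , b) → z ≡ combine a b
          z≡combine eq = ≡.trans (≡.sym (combine-remQuot {m} p z)) (≡.cong (uncurry combine) eq)
  ... | a , fsuc r = combine a r ,
        ≡.trans (≡.cong (uncurry λ a r → combine a (fsuc r)) (remQuot-combine a r))
                (≡.trans (≡.sym (≡.cong (uncurry combine) split)) (combine-remQuot {m} p z))

  Vertex : ℕ → Set
  Vertex n = Σ (Fin (suc n)) λ i → Fin (partSize p (toℕ i))

  -- Part i + 1 goes to the exponents p^(n-1-i) u with p ∤ u < p^(i+1),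
  -- i.e. to the elements of order p^(i+1) in the cyclic group of order p^n.
  exponent : ∀ n → Vertex n → ℕ
  exponent n (fzero  , _) = 0
  exponent n (fsuc i , x) = p ^ toℕ (opposite i) * toℕ (coprimeResidue (p ^ toℕ i) x)

  p^n-split : ∀ {n} (i : Fin n) → p ^ n ≡ p ^ toℕ (opposite i) * p ^ suc (toℕ i)
  p^n-split i = ≡.trans (^-split p (toℕ<n i))
                        (≡.cong (λ e → p ^ e * p ^ suc (toℕ i)) (≡.sym (opposite-prop i)))

  exponent-< : ∀ n v → exponent n v < p ^ n
  exponent-< n (fzero  , _) = m^n>0 p n
  exponent-< n (fsuc i , x) = begin-strict
    d * toℕ residue      <⟨ *-monoʳ-< d {{m^n≢0 p (toℕ (opposite i))}} residue< ⟩
    d * p ^ suc (toℕ i)  ≡⟨ p^n-split i ⟨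
    p ^ n                ∎
    where
    open ≤-Reasoning
    d = p ^ toℕ (opposite i)
    residue = coprimeResidue (p ^ toℕ i) x

    residue< : toℕ residue < p ^ suc (toℕ i)
    residue< = ≡.subst (toℕ residue <_) (*-comm (p ^ toℕ i) p) (toℕ<n residue)

  exponent-injectiveʳ : ∀ n i {x y} → exponent n (i , x) ≡ exponent n (i , y) → x ≡ y
  exponent-injectiveʳ n fzero    {fzero} {fzero} _ = ≡.refl
  exponent-injectiveʳ n (fsuc i) exponents-equal =
    coprimeResidue-injective {p ^ toℕ i} (toℕ-injective
      (*-cancelˡ-≡ _ _ (p ^ toℕ (opposite i)) {{m^n≢0 p (toℕ (opposite i))}} exponents-equal))

  exponent-hits : ∀ n (i : Fin n) u → ¬ p ∣ u → u < p ^ suc (toℕ i) →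
                  ∃ λ x → exponent n (fsuc i , x) ≡ p ^ toℕ (opposite i) * u
  exponent-hits n i u p∤u u<pⁱ⁺¹ = proj₁ residue , ≡.cong (p ^ toℕ (opposite i) *_)
    (≡.trans (≡.cong toℕ (proj₂ residue)) (toℕ-fromℕ< u<))
    where
    u< : u < p ^ toℕ i * p
    u< = ≡.subst (u <_) (*-comm p (p ^ toℕ i)) u<pⁱ⁺¹

    residue : ∃ λ x → coprimeResidue (p ^ toℕ i) x ≡ fromℕ< u<
    residue = coprimeResidue-surjective {p ^ toℕ i} (fromℕ< u<)
                (≡.subst (λ e → ¬ p ∣ e) (≡.sym (toℕ-fromℕ< u<)) p∤u)

  exponent-surjective : ∀ n k → k < p ^ n → ∃ λ v → exponent n v ≡ k
  exponent-surjective n zero    _     = (fzero , fzero) , ≡.refl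
  exponent-surjective n (suc k) k<pⁿ
    with j , u , k≡pʲu , p∤u ← p-adic-decomposition 1<p (suc k) z<s =
      (fsuc i , proj₁ hit) ,
      ≡.trans (proj₂ hit) (≡.trans (≡.cong (λ e → p ^ e * u) opposite-i≡j) (≡.sym k≡pʲu))
    where
    instance
      u≢0 : NonZero u
      u≢0 = ≢-nonZero λ u≡0 → p∤u (≡.subst (p ∣_) (≡.sym u≡0) (p ∣0))

    j<n : j < n
    j<n = ≰⇒> λ n≤j → <⇒≱ k<pⁿ (begin
      p ^ n      ≤⟨ ^-monoʳ-≤ p n≤j ⟩
      p ^ j      ≤⟨ m≤m*n (p ^ j) u ⟩
      p ^ j * u  ≡⟨ k≡pʲu ⟨
      suc k      ∎)
      where open ≤-Reasoning

    i : Fin n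
    i = opposite (fromℕ< j<n)

    opposite-i≡j : toℕ (opposite i) ≡ j
    opposite-i≡j = ≡.trans (≡.cong toℕ (opposite-involutive (fromℕ< j<n))) (toℕ-fromℕ< j<n)

    u<pⁱ⁺¹ : u < p ^ suc (toℕ i)
    u<pⁱ⁺¹ = *-cancelˡ-< (p ^ j) u _ (≡.subst₂ _<_ k≡pʲu
               (≡.trans (p^n-split i) (≡.cong (λ e → p ^ e * p ^ suc (toℕ i)) opposite-i≡j)) k<pⁿ)

    hit : ∃ λ x → exponent n (fsuc i , x) ≡ p ^ toℕ (opposite i) * u
    hit = exponent-hits n i u p∤u u<pⁱ⁺¹

module CyclicPrimePower {c ℓ} (q n : ℕ) (p-prime : Prime (suc (suc q))) (G : Group c ℓ)
                        (order : HasOrder G (suc (suc q) ^ n)) (cyclic : IsCyclic G) where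
  open Group G
  open GroupPowers G
  open PrimePowerExponents q
  open CyclicGroup G {{m^n≢0 p n}} order cyclic

  vertexElement : Vertex n → Carrier
  vertexElement v = pow G g (exponent n v)

  elemOrder-vertexElement : ∀ v → ElemOrder G (vertexElement v) (p ^ toℕ (proj₁ v))
  elemOrder-vertexElement (fzero  , _) = elemOrder-ε
  elemOrder-vertexElement (fsuc i , x) =
    elemOrder-pow (p ^ toℕ (opposite i)) (p ^ suc (toℕ i)) (toℕ (coprimeResidue (p ^ toℕ i) x))
      {{m^n≢0 p (toℕ (opposite i))}} {{m^n≢0 p (suc (toℕ i))}}
      pow-N≈ε pow≈ε⇒∣ (p^n-split i)
      (λ t → prime^∣*-cancelˡ p-prime (coprimeResidue-∤ (p ^ toℕ i) x) (suc (toℕ i)))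

  vertexElement-part : ∀ {v w} → vertexElement v ≈ vertexElement w → proj₁ v ≡ proj₁ w
  vertexElement-part {v} {w} gᵛ≈gʷ = toℕ-injective (^-injectiveʳ 1<p (elemOrder-unique
    (elemOrder-vertexElement v) (elemOrder-resp (sym gᵛ≈gʷ) (elemOrder-vertexElement w))))

  vertexElement-injective : ∀ {v w} → vertexElement v ≈ vertexElement w → v ≡ w
  vertexElement-injective {i , x} {j , y} gᵛ≈gʷ
    with ≡.refl ← vertexElement-part {i , x} {j , y} gᵛ≈gʷ =
      ≡.cong (i ,_) (exponent-injectiveʳ n i {x} {y}
        (pow-injective {exponent n (i , x)} {exponent n (i , y)}
          (exponent-< n (i , x)) (exponent-< n (i , y)) gᵛ≈gʷ))

  vertexElement-surjective : ∀ y → ∃ λ v → vertexElement v ≈ y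
  vertexElement-surjective y =
    proj₁ hit , trans (pow-congʳ g {exponent n (proj₁ hit)} {toℕ r} (proj₂ hit)) (proj₂ reduced)
    where
    reduced : ∃ λ (r : Fin (p ^ n)) → pow G g (toℕ r) ≈ y
    reduced = pow-reduce (p ^ n) {{m^n≢0 p n}} pow-N≈ε y

    r : Fin (p ^ n)
    r = proj₁ reduced

    hit : ∃ λ v → exponent n v ≡ toℕ r
    hit = exponent-surjective n (toℕ r) (toℕ<n r)

  vertexBijection : Bijection (≡.setoid (Vertex n)) setoid
  vertexBijection = record
    { to        = vertexElement
    ; cong      = λ { ≡.refl → refl }
    ; bijective = vertexElement-injective ,
                  strictlySurjective⇒surjective trans (λ { ≡.refl → refl }) vertexElement-surjective
    }

corollary5 : ∀ {c ℓ} (p n : ℕ) → Prime p → .{{_ : NonZero n}} →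
             (G : Group c ℓ) → HasOrder G (p ^ n) → IsCyclic G →
             OD G ≅G CompleteMultipartite (suc n) (λ i → partSize p (toℕ i))
corollary5 0 n prime[0] G order cyclic = ⊥-elim (¬prime[0] prime[0])
corollary5 1 n prime[1] G order cyclic = ⊥-elim (¬prime[1] prime[1])
corollary5 p@(suc (suc q)) n p-prime G order cyclic =
  OD≅CompleteMultipartite G (λ i → p ^ toℕ i)
    (λ pⁱ≡pʲ → toℕ-injective (^-injectiveʳ (s≤s (s≤s z≤n)) pⁱ≡pʲ))
    (λ i j → ^-∣-total p (toℕ i) (toℕ j))
    vertexBijection elemOrder-vertexElement
  where open CyclicPrimePower q n p-prime G order cyclic
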